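{- Fix integers $k \geq 1$, $j \geq 1$, $s \geq 0$, and a finite rooted ordered tree $\mathcal T$ of height $p \geq 2$. Let $\mathcal K$ be the infinite labeled tree built from $\mathcal T$ and $k,j,s$ as described in the context, let $R(n)$ be its leaf label counting function, $N(i)$ the largest label in the $i$-th block $\mathcal K_i$, and $\nu = \alpha - k(\beta - s + j)$, where $\alpha$ (resp. $\beta$) is the number of leaf labels (resp. penultimate labels) lying in $\mathcal K_1,\dots,\mathcal K_p$. Then for all $n > N(p+1)$, \[R(n) = \sum_{i=1}^k R\bigl(n-s-(i-1)j-R(n-ij)\bigr) + \nu .\] Equivalently, if a function $L$ satisfies $L(n) = \sum_{i=1}^k L(n-s-(i-1)j-L(n-ij)) + \nu$ for all $n > N(p+1)$ and $L(n) = R(n)$ for $1 \leq n \leq N(p+1)$, then $L(n) = R(n)$ for all $n \geq 1$.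
   Context: Construction of $\mathcal K$. The children of each node of $\mathcal T$ are linearly ordered; the height of $\mathcal T$ is the length of a longest path from the root to a node. Build finite ordered rooted trees $\mathcal K_1, \mathcal K_2, \dots$ as follows: $\mathcal K_p$ is a copy of $\mathcal T$; for $2 \leq i < p$, $\mathcal K_i$ is a copy of $\mathcal K_{i+1}$ with all of its leaves deleted; $\mathcal K_1$ is a copy of $\mathcal K_2$ with all its leaves deleted and with one extra node attached as the first child of its root; for $i > p$, $\mathcal K_i$ is a copy of $\mathcal K_{i-1}$ in which exactly $k$ new children are attached to each leaf. The root of $\mathcal K_i$ is called the $i$-th supernode; all other nodes are regular nodes. The infinite tree $\mathcal K$ consists of all the $\mathcal K_i$ together with, for each $i \geq 1$, an edge from the $i$-th supernode to the $(i+1)$-st supernode (so the $i$-th supernode is an additional child of the $(i+1)$-st). Traversal order: first the nodes of $\mathcal K_1$, in the order: the extra child, then the first supernode, then the remaining children of the first supernode in their order; then, for $i = 2,3,\dots$ successively, the nodes of $\mathcal K_i$ in the usual pre-order of $\mathcal K_i$ (node first, then the subtrees of its children in order). Labeling: each supernode receives $s$ labels and each regular node receives $j$ labels; the labels are the consecutive positive integers $1,2,3,\dots$ assigned following the traversal order (consecutively within a node). A leaf of $\mathcal K$ is a node with no children in $\mathcal K$; a label is a leaf label if it lies in a leaf of $\mathcal K$. A penultimate node is a non-leaf node of $\mathcal K$ all of whose children in $\mathcal K$ are leaves of $\mathcal K$; its labels are penultimate labels. $R(n)$ is the number of leaf labels that are $\leq n$. $N(i)$ denotes the largest label occurring in $\mathcal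 K_i$. -}

module Defs where

open import Data.Nat using (ℕ; zero; suc; _+_; _*_; _∸_; _⊔_; _≤ᵇ_)
open import Data.Bool using (Bool; true; false; _∧_; not; if_then_else_)
open import Data.List using (List; []; _∷_; _++_; length; replicate; take; null; filter; map; concat)
open import Data.Product using (_×_; _,_; proj₁; proj₂)
open import Data.Integer using (ℤ; +_; -[1+_]) renaming (_+_ to _+ℤ_)
open import Function using (_∘_)

data Tree : Set where
  node : List Tree → Tree

children : Tree → List Tree
children (node ts) = ts

isLeaf : Tree → Bool
isLeaf (node ts) = null ts

allLeaves : List Tree → Bool
allLeaves [] = true
allLeaves (t ∷ ts) = isLeaf t ∧ allLeaves ts

mutual
  height : Tree → ℕ
  height (node []) = 0
  height (node (t ∷ ts)) = suc (heights (t ∷ ts))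

  heights : List Tree → ℕ
  heights [] = 0
  heights (t ∷ ts) = height t ⊔ heights ts

mutual
  prune : Tree → Tree
  prune (node ts) = node (pruneList ts)

  pruneList : List Tree → List Tree
  pruneList [] = []
  pruneList (node [] ∷ ts) = pruneList ts
  pruneList (node (u ∷ us) ∷ ts) = prune (node (u ∷ us)) ∷ pruneList ts

mutual
  grow : ℕ → Tree → Tree
  grow k (node []) = node (replicate k (node []))
  grow k (node (t ∷ ts)) = node (growList k (t ∷ ts))

  growList : ℕ → List Tree → List Tree
  growList k [] = []
  growList k (t ∷ ts) = grow k t ∷ growList k ts

iterate : {A : Set} → (A → A) → ℕ → A → A
iterate f zero a = a
iterate f (suc n) a = f (iterate f n a)

-- The blocks 𝒦_i (i ≥ 1) built from T, p (= height of T) and k.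
-- For i = 1 we return 𝒦_2 with its leaves deleted; the extra first
-- child of the root of 𝒦_1 is handled explicitly below (block 1).

Kbase : Tree → ℕ → ℕ → ℕ → Tree
Kbase T p k i =
  if i ≤ᵇ p then iterate prune (p ∸ i) T
  else iterate (grow k) (i ∸ p) T

K₁ : Tree → ℕ → ℕ → Tree
K₁ T p k = node (node [] ∷ children (iterate prune (p ∸ 1) T))

K : Tree → ℕ → ℕ → ℕ → Tree
K T p k zero = node []            -- unused (blocks are indexed from 1)
K T p k (suc zero) = K₁ T p k
K T p k (suc (suc i)) = Kbase T p k (suc (suc i))

-- Information attached to a label: (is a leaf label , is a penultimate
-- label), computed w.r.t. the whole infinite tree 𝒦.

Info : Set
Info = Bool × Bool

-- information for a regular node (its children in 𝒦 = its children in 𝒦_i)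
regInfo : Tree → Info
regInfo (node ts) = null ts , (not (null ts) ∧ allLeaves ts)

mutual
  preorder : ℕ → Tree → List Info
  preorder j (node ts) = replicate j (regInfo (node ts)) ++ preorderList j ts

  preorderList : ℕ → List Tree → List Info
  preorderList j [] = []
  preorderList j (t ∷ ts) = preorder j t ++ preorderList j ts

-- Children in 𝒦 of the i-th supernode: the children of the root of 𝒦_i,
-- and additionally (for i ≥ 2) the (i-1)-st supernode.
-- Is the i-th supernode a leaf of 𝒦?
superLeaf : Tree → ℕ → ℕ → ℕ → Bool
superLeaf T p k zero = false
superLeaf T p k (suc zero) = null (children (K T p k 1))
superLeaf T p k (suc (suc i)) = false   -- it has the (i+1)-st supernode as a child

superPen : Tree → ℕ → ℕ → ℕ → Bool
superPen T p k zero = false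
superPen T p k (suc zero) =
  not (superLeaf T p k 1) ∧ allLeaves (children (K T p k 1))
superPen T p k (suc (suc i)) =
  not (superLeaf T p k (suc (suc i)))
  ∧ allLeaves (children (K T p k (suc (suc i))))
  ∧ superLeaf T p k (suc i)

superInfo : Tree → ℕ → ℕ → ℕ → Info
superInfo T p k i = superLeaf T p k i , superPen T p k i

block : Tree → ℕ → ℕ → ℕ → ℕ → ℕ → List Info
block T p k j s zero = []
block T p k j s (suc zero) with K T p k 1
... | node [] = []   -- impossible: the root of 𝒦_1 has the extra child
... | node (e ∷ cs) =
  -- the extra child, then the first supernode, then its remaining children
  replicate j (regInfo e) ++ replicate s (superInfo T p k 1) ++ preorderList j cs
block T p k j s (suc (suc i)) =
  replicate s (superInfo T p k (suc (suc i)))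
  ++ preorderList j (children (K T p k (suc (suc i))))

-- labels of 𝒦_1, …, 𝒦_m in traversal order (label n = n-th entry)
labelsUpTo : Tree → ℕ → ℕ → ℕ → ℕ → ℕ → List Info
labelsUpTo T p k j s zero = []
labelsUpTo T p k j s (suc m) = labelsUpTo T p k j s m ++ block T p k j s (suc m)

countTrue : List Bool → ℕ
countTrue [] = 0
countTrue (true ∷ bs) = suc (countTrue bs)
countTrue (false ∷ bs) = countTrue bs

N : Tree → ℕ → ℕ → ℕ → ℕ → ℕ → ℕ
N T p k j s i = length (labelsUpTo T p k j s i)

-- R(n): number of leaf labels ≤ n.  Every block contains at least one
-- label (a regular node carries j ≥ 1 labels), so the first n blocks
-- contain all labels ≤ n.
R : Tree → ℕ → ℕ → ℕ → ℕ → ℕ → ℕ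
R T p k j s n = countTrue (map proj₁ (take n (labelsUpTo T p k j s n)))

-- R extended to all integers (no positive label is ≤ n when n ≤ 0)
Rℤ : Tree → ℕ → ℕ → ℕ → ℕ → ℤ → ℤ
Rℤ T p k j s (+ n) = + (R T p k j s n)
Rℤ T p k j s -[1+ n ] = + 0

α : Tree → ℕ → ℕ → ℕ → ℕ → ℕ
α T p k j s = countTrue (map proj₁ (labelsUpTo T p k j s p))

β : Tree → ℕ → ℕ → ℕ → ℕ → ℕ
β T p k j s = countTrue (map proj₂ (labelsUpTo T p k j s p))

sumFrom1 : ℕ → (ℕ → ℤ) → ℤ
sumFrom1 zero f = + 0
sumFrom1 (suc k) f = sumFrom1 k f +ℤ f (suc k)

-- Beyond 𝒦_p every block arises from its predecessor by giving each leaf k new children, so in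
-- pre-order each penultimate node, with its j labels, is immediately followed by its k leaf
-- children, whose labels are its own shifted by j, 2j, …, kj.  Hence, writing P(x) for the number
-- of penultimate labels ≤ x, R(n) + kβ = α + Σᵢ P(n − ij).  Conversely 𝒦_i is 𝒦_{i+1} with its
-- leaves deleted, and a non-leaf node is penultimate exactly when pruning turns it into a leaf;
-- so the penultimate flags of the non-leaf labels reproduce the leaf flags of the whole label
-- sequence, the j labels of the extra child being traded for the s labels of the first supernode.
-- Counting gives P(x) + j = s + R(x − R(x) − s + j), and substituting this into the first
-- identity yields the recurrence.

module Submission where

open import Defs
open import Data.Nat using (ℕ; zero; suc; _≤_; _<_)
open import Relation.Binary.PropositionalEquality using (_≡_; refl; sym; trans; cong; cong₂; subst; subst₂; module ≡-Reasoning)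

-- ℕ arithmetic is opened only inside this block, so that the statement at the end reads over ℤ.
module _ where
  open import Data.Nat using (_+_; _*_; _∸_; _⊔_; _≤ᵇ_; z≤n; s≤s)
  open import Data.Nat.Properties
  open import Algebra.Properties.CommutativeSemigroup +-commutativeSemigroup using (interchange)
  open import Data.Bool using (Bool; true; false; _∧_)
  open import Data.Bool.Properties using (∧-zeroʳ; T-≡; ¬-not)
  open import Data.List using (List; []; _∷_; _++_; length; replicate; take; map; null)
  open import Data.List.Properties
    using (map-++; length-map; length-replicate; map-replicate; ++-identityʳ; ++-assoc; take-map; length-++; length-++-≤ˡ; length-++-≤ʳ)
  open import Data.List.Relation.Unary.All using (All; []; _∷_)
  open import Data.List.Relation.Unary.All.Properties using (++⁺; replicate⁺)
  open import Data.Product using (Σ-syntax; _×_; _,_; proj₁; proj₂)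
  open import Relation.Nullary using (yes; no)
  open import Relation.Binary.Definitions using (tri<; tri≈; tri>)
  open import Function.Bundles using (Equivalence)
  open import Data.Nat.Tactic.RingSolver using (solve-∀)
  open ≡-Reasoning

  -- Counting flags in prefixes

  countTrue-replicate-true : ∀ m → countTrue (replicate m true) ≡ m
  countTrue-replicate-true zero = refl
  countTrue-replicate-true (suc m) = cong suc (countTrue-replicate-true m)

  countUpTo : ℕ → List Bool → ℕ
  countUpTo t bs = countTrue (take t bs)

  countUpTo-++ : ∀ t as bs → countUpTo t (as ++ bs) ≡ countUpTo t as + countUpTo (t ∸ length as) bs
  countUpTo-++ zero [] bs = refl
  countUpTo-++ zero (_ ∷ _) bs = refl
  countUpTo-++ (suc t) [] bs = refl
  countUpTo-++ (suc t) (true ∷ as) bs = cong suc (countUpTo-++ t as bs)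
  countUpTo-++ (suc t) (false ∷ as) bs = countUpTo-++ t as bs

  countUpTo-map-++ : ∀ {A : Set} (f : A → Bool) t as bs →
    countUpTo t (map f (as ++ bs)) ≡ countUpTo t (map f as) + countUpTo (t ∸ length as) (map f bs)
  countUpTo-map-++ f t as bs = begin
    countUpTo t (map f (as ++ bs))
      ≡⟨ cong (countUpTo t) (map-++ f as bs) ⟩
    countUpTo t (map f as ++ map f bs)
      ≡⟨ countUpTo-++ t (map f as) (map f bs) ⟩
    countUpTo t (map f as) + countUpTo (t ∸ length (map f as)) (map f bs)
      ≡⟨ cong (λ l → countUpTo t (map f as) + countUpTo (t ∸ l) (map f bs)) (length-map f as) ⟩
    countUpTo t (map f as) + countUpTo (t ∸ length as) (map f bs)
      ∎

  countUpTo≤ : ∀ t bs → countUpTo t bs ≤ t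
  countUpTo≤ zero bs = z≤n
  countUpTo≤ (suc t) [] = z≤n
  countUpTo≤ (suc t) (true ∷ bs) = s≤s (countUpTo≤ t bs)
  countUpTo≤ (suc t) (false ∷ bs) = m≤n⇒m≤1+n (countUpTo≤ t bs)

  countUpTo-complete : ∀ t bs → length bs ≤ t → countUpTo t bs ≡ countTrue bs
  countUpTo-complete zero [] _ = refl
  countUpTo-complete (suc t) [] _ = refl
  countUpTo-complete (suc t) (true ∷ bs) (s≤s l≤t) = cong suc (countUpTo-complete t bs l≤t)
  countUpTo-complete (suc t) (false ∷ bs) (s≤s l≤t) = countUpTo-complete t bs l≤t

  countUpTo-++-within : ∀ t as bs → t ≤ length as → countUpTo t (as ++ bs) ≡ countUpTo t as
  countUpTo-++-within t as bs t≤l = begin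
    countUpTo t (as ++ bs)                                  ≡⟨ countUpTo-++ t as bs ⟩
    countUpTo t as + countUpTo (t ∸ length as) bs           ≡⟨ cong (λ u → countUpTo t as + countUpTo u bs) (m≤n⇒m∸n≡0 t≤l) ⟩
    countUpTo t as + 0                                      ≡⟨ +-identityʳ _ ⟩
    countUpTo t as                                          ∎

  countUpTo-≤-++ : ∀ t as bs → countUpTo t as ≤ countUpTo t (as ++ bs)
  countUpTo-≤-++ t as bs = subst (countUpTo t as ≤_) (sym (countUpTo-++ t as bs)) (m≤m+n _ _)

  countUpTo-++-past : ∀ t as bs → length as ≤ t → countUpTo t (as ++ bs) ≡ countTrue as + countUpTo (t ∸ length as) bs
  countUpTo-++-past t as bs l≤t = trans (countUpTo-++ t as bs) (cong (_+ countUpTo (t ∸ length as) bs) (countUpTo-complete t as l≤t))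

  countUpTo-replicate-true-++ : ∀ t m bs → m ≤ t → countUpTo t (replicate m true ++ bs) ≡ m + countUpTo (t ∸ m) bs
  countUpTo-replicate-true-++ t m bs m≤t = begin
    countUpTo t (replicate m true ++ bs)
      ≡⟨ countUpTo-++-past t (replicate m true) bs (subst (_≤ t) (sym (length-replicate m)) m≤t) ⟩
    countTrue (replicate m true) + countUpTo (t ∸ length (replicate m true)) bs
      ≡⟨ cong₂ (λ c l → c + countUpTo (t ∸ l) bs) (countTrue-replicate-true m) (length-replicate m) ⟩
    m + countUpTo (t ∸ m) bs
      ∎

  countUpTo-replicate-false : ∀ t m → countUpTo t (replicate m false) ≡ 0
  countUpTo-replicate-false zero m = refl
  countUpTo-replicate-false (suc t) zero = refl
  countUpTo-replicate-false (suc t) (suc m) = countUpTo-replicate-false t m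

  ∑ : ℕ → (ℕ → ℕ) → ℕ
  ∑ zero f = 0
  ∑ (suc k) f = ∑ k f + f (suc k)

  ∑-cong : ∀ k {f g : ℕ → ℕ} → (∀ i → 1 ≤ i → i ≤ k → f i ≡ g i) → ∑ k f ≡ ∑ k g
  ∑-cong zero eq = refl
  ∑-cong (suc k) eq = cong₂ _+_ (∑-cong k (λ i 1≤i i≤k → eq i 1≤i (m≤n⇒m≤1+n i≤k))) (eq (suc k) (s≤s z≤n) ≤-refl)

  ∑-distrib-+ : ∀ k (f g : ℕ → ℕ) → ∑ k (λ i → f i + g i) ≡ ∑ k f + ∑ k g
  ∑-distrib-+ zero f g = refl
  ∑-distrib-+ (suc k) f g = trans (cong (_+ (f (suc k) + g (suc k))) (∑-distrib-+ k f g)) (interchange (∑ k f) (∑ k g) (f (suc k)) (g (suc k)))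

  ∑-const : ∀ k c → ∑ k (λ _ → c) ≡ k * c
  ∑-const zero c = refl
  ∑-const (suc k) c = trans (cong (_+ c) (∑-const k c)) (+-comm (k * c) c)

  replicate-+ : ∀ {A : Set} m n (x : A) → replicate (m + n) x ≡ replicate m x ++ replicate n x
  replicate-+ zero n x = refl
  replicate-+ (suc m) n x = cong (x ∷_) (replicate-+ m n x)

  countUpTo-replicate-true-chunks : ∀ j k t →
    countUpTo (t ∸ j) (replicate (k * j) true) ≡ ∑ k (λ i → countUpTo (t ∸ i * j) (replicate j true))
  countUpTo-replicate-true-chunks j zero t = countUpTo-replicate-false (t ∸ j) 0
  countUpTo-replicate-true-chunks j (suc k) t = begin
    countUpTo (t ∸ j) (replicate (j + k * j) true)
      ≡⟨ cong (λ m → countUpTo (t ∸ j) (replicate m true)) (+-comm j (k * j)) ⟩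
    countUpTo (t ∸ j) (replicate (k * j + j) true)
      ≡⟨ cong (countUpTo (t ∸ j)) (replicate-+ (k * j) j true) ⟩
    countUpTo (t ∸ j) (replicate (k * j) true ++ replicate j true)
      ≡⟨ countUpTo-++ (t ∸ j) (replicate (k * j) true) (replicate j true) ⟩
    countUpTo (t ∸ j) (replicate (k * j) true) + countUpTo (t ∸ j ∸ length (replicate (k * j) true)) (replicate j true)
      ≡⟨ cong₂ _+_ (countUpTo-replicate-true-chunks j k t) (cong (λ u → countUpTo u (replicate j true)) shift) ⟩
    ∑ k (λ i → countUpTo (t ∸ i * j) (replicate j true)) + countUpTo (t ∸ suc k * j) (replicate j true)
      ∎
    where
    shift : t ∸ j ∸ length (replicate (k * j) true) ≡ t ∸ suc k * j
    shift = trans (cong (t ∸ j ∸_) (length-replicate (k * j))) (∸-+-assoc t j (k * j))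

  -- Balanced label sequences

  leafLabel penLabel plainLabel : Info
  leafLabel = true , false
  penLabel = false , true
  plainLabel = false , false

  leafFlags penFlags : List Info → List Bool
  leafFlags = map proj₁
  penFlags = map proj₂

  record Balanced (k j : ℕ) (w : List Info) : Set where
    constructor balanced
    field count : ∀ t → countUpTo t (leafFlags w) ≡ ∑ k (λ i → countUpTo (t ∸ i * j) (penFlags w))

  ∸-comm : ∀ m n o → m ∸ n ∸ o ≡ m ∸ o ∸ n
  ∸-comm m n o = trans (∸-+-assoc m n o) (trans (cong (m ∸_) (+-comm n o)) (sym (∸-+-assoc m o n)))

  module _ {k j : ℕ} where

    Balanced-++ : ∀ {as bs} → Balanced k j as → Balanced k j bs → Balanced k j (as ++ bs)
    Balanced-++ {as} {bs} (balanced bal-as) (balanced bal-bs) = balanced λ t → begin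
      countUpTo t (leafFlags (as ++ bs))
        ≡⟨ countUpTo-map-++ proj₁ t as bs ⟩
      countUpTo t (leafFlags as) + countUpTo (t ∸ length as) (leafFlags bs)
        ≡⟨ cong₂ _+_ (bal-as t) (bal-bs (t ∸ length as)) ⟩
      ∑ k (λ i → countUpTo (t ∸ i * j) (penFlags as)) + ∑ k (λ i → countUpTo (t ∸ length as ∸ i * j) (penFlags bs))
        ≡⟨ sym (∑-distrib-+ k _ _) ⟩
      ∑ k (λ i → countUpTo (t ∸ i * j) (penFlags as) + countUpTo (t ∸ length as ∸ i * j) (penFlags bs))
        ≡⟨ ∑-cong k (λ i _ _ → sym (split t i)) ⟩
      ∑ k (λ i → countUpTo (t ∸ i * j) (penFlags (as ++ bs)))
        ∎
      where
      split : ∀ t i → countUpTo (t ∸ i * j) (penFlags (as ++ bs))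
                      ≡ countUpTo (t ∸ i * j) (penFlags as) + countUpTo (t ∸ length as ∸ i * j) (penFlags bs)
      split t i = trans (countUpTo-map-++ proj₂ (t ∸ i * j) as bs)
                      (cong (λ u → countUpTo (t ∸ i * j) (penFlags as) + countUpTo u (penFlags bs)) (∸-comm t (i * j) (length as)))

    Balanced-plain : ∀ m → Balanced k j (replicate m plainLabel)
    Balanced-plain m = balanced λ t → begin
      countUpTo t (leafFlags (replicate m plainLabel))        ≡⟨ noFlags refl t ⟩
      0                                                       ≡⟨ sym (*-zeroʳ k) ⟩
      k * 0                                                   ≡⟨ sym (∑-const k 0) ⟩
      ∑ k (λ _ → 0)                                           ≡⟨ ∑-cong k (λ i _ _ → sym (noFlags refl (t ∸ i * j))) ⟩
      ∑ k (λ i → countUpTo (t ∸ i * j) (penFlags (replicate m plainLabel))) ∎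
      where
      noFlags : ∀ {f : Info → Bool} → f plainLabel ≡ false → ∀ u → countUpTo u (map f (replicate m plainLabel)) ≡ 0
      noFlags {f} f-inner u =
        trans (cong (countUpTo u) (trans (map-replicate f m plainLabel) (cong (replicate m) f-inner))) (countUpTo-replicate-false u m)

    -- a penultimate node of a grown block followed, in pre-order, by its k leaf children
    Balanced-family : Balanced k j (replicate j penLabel ++ replicate (k * j) leafLabel)
    Balanced-family = balanced λ t → begin
      countUpTo t (leafFlags (replicate j penLabel ++ replicate (k * j) leafLabel))
        ≡⟨ countUpTo-map-++ proj₁ t (replicate j penLabel) (replicate (k * j) leafLabel) ⟩
      countUpTo t (leafFlags (replicate j penLabel)) + countUpTo (t ∸ length (replicate j penLabel)) (leafFlags (replicate (k * j) leafLabel))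
        ≡⟨ cong₂ _+_ (trans (cong (countUpTo t) (map-replicate proj₁ j penLabel)) (countUpTo-replicate-false t j))
                     (cong₂ (λ l bs → countUpTo (t ∸ l) bs) (length-replicate j) (map-replicate proj₁ (k * j) leafLabel)) ⟩
      countUpTo (t ∸ j) (replicate (k * j) true)
        ≡⟨ countUpTo-replicate-true-chunks j k t ⟩
      ∑ k (λ i → countUpTo (t ∸ i * j) (replicate j true))
        ≡⟨ ∑-cong k (λ i _ _ → sym (penFlags-count (t ∸ i * j))) ⟩
      ∑ k (λ i → countUpTo (t ∸ i * j) (penFlags (replicate j penLabel ++ replicate (k * j) leafLabel)))
        ∎
      where
      penFlags-count : ∀ u → countUpTo u (penFlags (replicate j penLabel ++ replicate (k * j) leafLabel)) ≡ countUpTo u (replicate j true)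
      penFlags-count u = begin
        countUpTo u (penFlags (replicate j penLabel ++ replicate (k * j) leafLabel))
          ≡⟨ countUpTo-map-++ proj₂ u (replicate j penLabel) (replicate (k * j) leafLabel) ⟩
        countUpTo u (penFlags (replicate j penLabel)) + countUpTo (u ∸ length (replicate j penLabel)) (penFlags (replicate (k * j) leafLabel))
          ≡⟨ cong₂ _+_ (cong (countUpTo u) (map-replicate proj₂ j penLabel))
                       (trans (cong (countUpTo v) (map-replicate proj₂ (k * j) leafLabel)) (countUpTo-replicate-false v (k * j))) ⟩
        countUpTo u (replicate j true) + 0
          ≡⟨ +-identityʳ _ ⟩
        countUpTo u (replicate j true)
          ∎
        where v = u ∸ length (replicate j penLabel)

  -- Pruning, growing and pre-order labelling of trees

  pattern leaf = node []

  allLeaves-replicate-leaf : ∀ m → allLeaves (replicate m leaf) ≡ true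
  allLeaves-replicate-leaf zero = refl
  allLeaves-replicate-leaf (suc m) = allLeaves-replicate-leaf m

  pruneList-replicate-leaf : ∀ m → pruneList (replicate m leaf) ≡ []
  pruneList-replicate-leaf zero = refl
  pruneList-replicate-leaf (suc m) = pruneList-replicate-leaf m

  preorderList-replicate-leaf : ∀ j m → preorderList j (replicate m leaf) ≡ replicate (m * j) leafLabel
  preorderList-replicate-leaf j zero = refl
  preorderList-replicate-leaf j (suc m) = begin
    (replicate j leafLabel ++ []) ++ preorderList j (replicate m leaf)
      ≡⟨ cong₂ _++_ (++-identityʳ _) (preorderList-replicate-leaf j m) ⟩
    replicate j leafLabel ++ replicate (m * j) leafLabel
      ≡⟨ sym (replicate-+ j (m * j) leafLabel) ⟩
    replicate (j + m * j) leafLabel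
      ∎

  node-children : ∀ t → node (children t) ≡ t
  node-children (node _) = refl

  children-prune : ∀ t → children (prune t) ≡ pruneList (children t)
  children-prune (node _) = refl

  module _ {k : ℕ} where

    isLeaf-grow : ∀ t → isLeaf (grow (suc k) t) ≡ false
    isLeaf-grow leaf = refl
    isLeaf-grow (node (_ ∷ _)) = refl

    children-grow : ∀ t → isLeaf t ≡ false → children (grow (suc k) t) ≡ growList (suc k) (children t)
    children-grow (node (_ ∷ _)) _ = refl

    regInfo-grow-plain : ∀ t → isLeaf t ≡ false → regInfo (grow (suc k) t) ≡ plainLabel
    regInfo-grow-plain (node (u ∷ us)) _ = cong (λ b → false , b ∧ allLeaves (growList (suc k) us)) (isLeaf-grow u)

    mutual
      prune-grow : ∀ t → prune (grow (suc k) t) ≡ t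
      prune-grow leaf = cong node (pruneList-replicate-leaf k)
      prune-grow (node ts@(_ ∷ _)) = cong node (pruneList-growList ts)

      pruneList-growList : ∀ ts → pruneList (growList (suc k) ts) ≡ ts
      pruneList-growList [] = refl
      pruneList-growList (t ∷ ts) = trans (pruneList-∷ t) (cong₂ _∷_ (prune-grow t) (pruneList-growList ts))
        where
        pruneList-∷ : ∀ t → pruneList (grow (suc k) t ∷ growList (suc k) ts) ≡ prune (grow (suc k) t) ∷ pruneList (growList (suc k) ts)
        pruneList-∷ leaf = refl
        pruneList-∷ (node (_ ∷ _)) = refl

  module _ {k j : ℕ} where

    mutual
      Balanced-preorder-grow : ∀ t → Balanced (suc k) j (preorder j (grow (suc k) t))
      Balanced-preorder-grow leaf = subst (Balanced (suc k) j) (sym family) Balanced-family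
        where
        family : preorder j (grow (suc k) leaf) ≡ replicate j penLabel ++ replicate (suc k * j) leafLabel
        family = cong₂ (λ b w → replicate j (false , b) ++ w) (allLeaves-replicate-leaf k) (preorderList-replicate-leaf j (suc k))
      Balanced-preorder-grow t@(node ts@(_ ∷ _)) =
        subst (λ x → Balanced (suc k) j (replicate j x ++ preorderList j (growList (suc k) ts)))
              (sym (regInfo-grow-plain t refl))
              (Balanced-++ (Balanced-plain j) (Balanced-preorderList-grow ts))

      Balanced-preorderList-grow : ∀ ts → Balanced (suc k) j (preorderList j (growList (suc k) ts))
      Balanced-preorderList-grow [] = Balanced-plain 0
      Balanced-preorderList-grow (t ∷ ts) =
        Balanced-++ (Balanced-preorder-grow t) (Balanced-preorderList-grow ts)

  length-preorder-grow : ∀ k j t → k * j ≤ length (preorder j (grow k t))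
  length-preorder-grow k j leaf =
    ≤-trans (≤-reflexive (sym leafLabels)) (length-++-≤ʳ (preorderList j (replicate k leaf)) {replicate j (regInfo (node (replicate k leaf)))})
    where
    leafLabels : length (preorderList j (replicate k leaf)) ≡ k * j
    leafLabels = trans (cong length (preorderList-replicate-leaf j k)) (length-replicate (k * j))
  length-preorder-grow k j (node (t ∷ ts)) =
    ≤-trans (length-preorder-grow k j t)
            (≤-trans (length-++-≤ˡ (preorder j (grow k t)))
                     (length-++-≤ʳ (preorderList j (growList k (t ∷ ts))) {replicate j (regInfo (node (growList k (t ∷ ts))))}))

  length-preorderList-growList : ∀ k j t → isLeaf t ≡ false → k * j ≤ length (preorderList j (growList k (children t)))
  length-preorderList-growList k j (node (u ∷ us)) _ =
    ≤-trans (length-preorder-grow k j u) (length-++-≤ˡ (preorder j (grow k u)))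

  length-preorderList-children : ∀ j t → isLeaf t ≡ false → j ≤ length (preorderList j (children t))
  length-preorderList-children j (node (u@(node _) ∷ us)) _ =
    ≤-trans (≤-reflexive (sym (length-replicate j)))
            (≤-trans (length-++-≤ˡ (replicate j (regInfo u))) (length-++-≤ˡ (preorder j u)))

  innerPenFlags : List Info → List Bool
  innerPenFlags [] = []
  innerPenFlags ((true , _) ∷ w) = innerPenFlags w
  innerPenFlags ((false , pen) ∷ w) = pen ∷ innerPenFlags w

  innerPenFlags-++ : ∀ as bs → innerPenFlags (as ++ bs) ≡ innerPenFlags as ++ innerPenFlags bs
  innerPenFlags-++ [] bs = refl
  innerPenFlags-++ ((true , _) ∷ as) bs = innerPenFlags-++ as bs
  innerPenFlags-++ ((false , pen) ∷ as) bs = cong (pen ∷_) (innerPenFlags-++ as bs)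

  innerPenFlags-replicate-leaf : ∀ m b → innerPenFlags (replicate m (true , b)) ≡ []
  innerPenFlags-replicate-leaf zero b = refl
  innerPenFlags-replicate-leaf (suc m) b = innerPenFlags-replicate-leaf m b

  innerPenFlags-replicate-inner : ∀ m b → innerPenFlags (replicate m (false , b)) ≡ replicate m b
  innerPenFlags-replicate-inner zero b = refl
  innerPenFlags-replicate-inner (suc m) b = cong (b ∷_) (innerPenFlags-replicate-inner m b)

  allLeaves≡null-pruneList : ∀ ts → allLeaves ts ≡ null (pruneList ts)
  allLeaves≡null-pruneList [] = refl
  allLeaves≡null-pruneList (leaf ∷ ts) = allLeaves≡null-pruneList ts
  allLeaves≡null-pruneList (node (_ ∷ _) ∷ ts) = refl

  leafFlags-preorder : ∀ j ts → leafFlags (preorder j (node ts)) ≡ replicate j (null ts) ++ leafFlags (preorderList j ts)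
  leafFlags-preorder j ts =
    trans (map-++ proj₁ (replicate j (regInfo (node ts))) _) (cong (_++ leafFlags (preorderList j ts)) (map-replicate proj₁ j (regInfo (node ts))))

  innerPenFlags-preorderList : ∀ j ts → innerPenFlags (preorderList j ts) ≡ leafFlags (preorderList j (pruneList ts))
  innerPenFlags-preorderList j [] = refl
  innerPenFlags-preorderList j (leaf ∷ ts) = begin
    innerPenFlags ((replicate j leafLabel ++ []) ++ preorderList j ts)
      ≡⟨ innerPenFlags-++ (replicate j leafLabel ++ []) _ ⟩
    innerPenFlags (replicate j leafLabel ++ []) ++ innerPenFlags (preorderList j ts)
      ≡⟨ cong (_++ innerPenFlags (preorderList j ts))
              (trans (innerPenFlags-++ (replicate j leafLabel) []) (cong (_++ []) (innerPenFlags-replicate-leaf j false))) ⟩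
    innerPenFlags (preorderList j ts)
      ≡⟨ innerPenFlags-preorderList j ts ⟩
    leafFlags (preorderList j (pruneList ts))
      ∎
  innerPenFlags-preorderList j (node us@(_ ∷ _) ∷ ts) = begin
    innerPenFlags ((replicate j (false , allLeaves us) ++ preorderList j us) ++ preorderList j ts)
      ≡⟨ innerPenFlags-++ (replicate j (false , allLeaves us) ++ preorderList j us) _ ⟩
    innerPenFlags (replicate j (false , allLeaves us) ++ preorderList j us) ++ innerPenFlags (preorderList j ts)
      ≡⟨ cong (_++ innerPenFlags (preorderList j ts)) (innerPenFlags-++ (replicate j (false , allLeaves us)) _) ⟩
    (innerPenFlags (replicate j (false , allLeaves us)) ++ innerPenFlags (preorderList j us)) ++ innerPenFlags (preorderList j ts)
      ≡⟨ cong₂ (λ xs ys → (xs ++ ys) ++ _) (innerPenFlags-replicate-inner j (allLeaves us)) (innerPenFlags-preorderList j us) ⟩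
    (replicate j (allLeaves us) ++ leafFlags (preorderList j (pruneList us))) ++ innerPenFlags (preorderList j ts)
      ≡⟨ cong₂ (λ b ys → (replicate j b ++ leafFlags (preorderList j (pruneList us))) ++ ys)
               (allLeaves≡null-pruneList us) (innerPenFlags-preorderList j ts) ⟩
    (replicate j (null (pruneList us)) ++ leafFlags (preorderList j (pruneList us))) ++ leafFlags (preorderList j (pruneList ts))
      ≡⟨ cong (_++ leafFlags (preorderList j (pruneList ts))) (sym (leafFlags-preorder j (pruneList us))) ⟩
    leafFlags (preorder j (node (pruneList us))) ++ leafFlags (preorderList j (pruneList ts))
      ≡⟨ sym (map-++ proj₁ (preorder j (node (pruneList us))) _) ⟩
    leafFlags (preorderList j (pruneList (node us ∷ ts)))
      ∎

  height-pruneList : ∀ ts → height (node (pruneList ts)) ≡ heights ts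
  height-pruneList [] = refl
  height-pruneList (leaf ∷ ts) = height-pruneList ts
  height-pruneList (node us@(_ ∷ _) ∷ ts) = begin
    suc (height (node (pruneList us)) ⊔ heights (pruneList ts))  ≡⟨ cong (λ h → suc (h ⊔ heights (pruneList ts))) (height-pruneList us) ⟩
    suc (heights us ⊔ heights (pruneList ts))                    ≡⟨ suc-⊔ (heights us) (pruneList ts) ⟩
    suc (heights us) ⊔ height (node (pruneList ts))              ≡⟨ cong (suc (heights us) ⊔_) (height-pruneList ts) ⟩
    suc (heights us) ⊔ heights ts                                ∎
    where
    suc-⊔ : ∀ h vs → suc (h ⊔ heights vs) ≡ suc h ⊔ height (node vs)
    suc-⊔ h [] = cong suc (⊔-identityʳ h)
    suc-⊔ h (_ ∷ _) = refl

  height-prune : ∀ t → height (prune t) ≡ height t ∸ 1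
  height-prune leaf = refl
  height-prune (node ts@(_ ∷ _)) = height-pruneList ts

  height-iterate-prune : ∀ m t → height (iterate prune m t) ≡ height t ∸ m
  height-iterate-prune zero t = refl
  height-iterate-prune (suc m) t = begin
    height (prune (iterate prune m t))   ≡⟨ height-prune (iterate prune m t) ⟩
    height (iterate prune m t) ∸ 1       ≡⟨ cong (_∸ 1) (height-iterate-prune m t) ⟩
    height t ∸ m ∸ 1                     ≡⟨ ∸-+-assoc (height t) m 1 ⟩
    height t ∸ (m + 1)                   ≡⟨ cong (height t ∸_) (+-comm m 1) ⟩
    height t ∸ suc m                     ∎

  allLeaves-heights≡0 : ∀ ts → heights ts ≡ 0 → allLeaves ts ≡ true
  allLeaves-heights≡0 [] _ = refl
  allLeaves-heights≡0 (leaf ∷ ts) h = allLeaves-heights≡0 ts h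
  allLeaves-heights≡0 (node (u ∷ us) ∷ ts) h with subst (suc (heights (u ∷ us)) ≤_) h (m≤m⊔n _ (heights ts))
  ... | ()

  allLeaves-height≡1 : ∀ ts → height (node ts) ≡ 1 → allLeaves ts ≡ true
  allLeaves-height≡1 [] _ = refl
  allLeaves-height≡1 ts@(_ ∷ _) h = allLeaves-heights≡0 ts (suc-injective h)

  isLeaf-height≡suc : ∀ t {h} → height t ≡ suc h → isLeaf t ≡ false
  isLeaf-height≡suc (node (_ ∷ _)) _ = refl

  Exclusive : Info → Set
  Exclusive (isLeafLabel , isPenLabel) = isLeafLabel ≡ true → isPenLabel ≡ false

  Exclusive-regInfo : ∀ t → Exclusive (regInfo t)
  Exclusive-regInfo leaf _ = refl
  Exclusive-regInfo (node (_ ∷ _)) ()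

  mutual
    Exclusive-preorder : ∀ j t → All Exclusive (preorder j t)
    Exclusive-preorder j t@(node ts) = ++⁺ (replicate⁺ j (Exclusive-regInfo t)) (Exclusive-preorderList j ts)

    Exclusive-preorderList : ∀ j ts → All Exclusive (preorderList j ts)
    Exclusive-preorderList j [] = []
    Exclusive-preorderList j (t ∷ ts) = ++⁺ (Exclusive-preorder j t) (Exclusive-preorderList j ts)

  countUpTo-penFlags : ∀ w → All Exclusive w → ∀ x →
    countUpTo x (penFlags w) ≡ countUpTo (x ∸ countUpTo x (leafFlags w)) (innerPenFlags w)
  countUpTo-penFlags [] _ zero = refl
  countUpTo-penFlags [] _ (suc x) = refl
  countUpTo-penFlags (_ ∷ w) _ zero = refl
  countUpTo-penFlags ((true , false) ∷ w) (_ ∷ ex) (suc x) = countUpTo-penFlags w ex x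
  countUpTo-penFlags ((true , true) ∷ w) (ex₀ ∷ _) (suc x) with ex₀ refl
  ... | ()
  countUpTo-penFlags ((false , true) ∷ w) (_ ∷ ex) (suc x)
    rewrite +-∸-assoc 1 (countUpTo≤ x (leafFlags w)) = cong suc (countUpTo-penFlags w ex x)
  countUpTo-penFlags ((false , false) ∷ w) (_ ∷ ex) (suc x)
    rewrite +-∸-assoc 1 (countUpTo≤ x (leafFlags w)) = countUpTo-penFlags w ex x

  countTrue-innerPenFlags : ∀ w → All Exclusive w → countTrue (innerPenFlags w) ≡ countTrue (penFlags w)
  countTrue-innerPenFlags [] _ = refl
  countTrue-innerPenFlags ((true , false) ∷ w) (_ ∷ ex) = countTrue-innerPenFlags w ex
  countTrue-innerPenFlags ((true , true) ∷ w) (ex₀ ∷ _) with ex₀ refl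
  ... | ()
  countTrue-innerPenFlags ((false , true) ∷ w) (_ ∷ ex) = cong suc (countTrue-innerPenFlags w ex)
  countTrue-innerPenFlags ((false , false) ∷ w) (_ ∷ ex) = countTrue-innerPenFlags w ex

  -- The labelled tree 𝒦

  module LabeledTree (k' j' s p' : ℕ) (T : Tree) (height-T : height T ≡ suc (suc p')) where

    k j p : ℕ
    k = suc k'
    j = suc j'
    p = suc (suc p')

    -- the i-th block for i ≥ 2; 𝒦 1 lacks the extra first child of the first block
    𝒦 : ℕ → Tree
    𝒦 = Kbase T p k

    labels : ℕ → List Info
    labels = labelsUpTo T p k j s

    blockLabels : ℕ → List Info
    blockLabels = block T p k j s

    𝒦-pruned : ∀ {i} → i ≤ p → 𝒦 i ≡ iterate prune (p ∸ i) T
    𝒦-pruned i≤p rewrite Equivalence.to T-≡ (≤⇒≤ᵇ i≤p) = refl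

    𝒦-grown : ∀ {i} → p < i → 𝒦 i ≡ grow k (iterate (grow k) (i ∸ suc p) T)
    𝒦-grown {i} p<i rewrite ¬-not {i ≤ᵇ p} (λ i≤ᵇp → <⇒≱ p<i (≤ᵇ⇒≤ i p (Equivalence.from T-≡ i≤ᵇp))) =
      cong (λ m → iterate (grow k) m T) (+-∸-assoc 1 p<i)

    isLeaf-iterate-grow : ∀ m → isLeaf (iterate (grow k) m T) ≡ false
    isLeaf-iterate-grow zero = isLeaf-height≡suc T height-T
    isLeaf-iterate-grow (suc m) = isLeaf-grow (iterate (grow k) m T)

    height-𝒦 : ∀ {i} → i ≤ p → height (𝒦 i) ≡ i
    height-𝒦 {i} i≤p = begin
      height (𝒦 i)                         ≡⟨ cong height (𝒦-pruned i≤p) ⟩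
      height (iterate prune (p ∸ i) T)     ≡⟨ height-iterate-prune (p ∸ i) T ⟩
      height T ∸ (p ∸ i)                   ≡⟨ cong (_∸ (p ∸ i)) height-T ⟩
      p ∸ (p ∸ i)                          ≡⟨ m∸[m∸n]≡n i≤p ⟩
      i                                    ∎

    isLeaf-𝒦 : ∀ i → isLeaf (𝒦 (suc i)) ≡ false
    isLeaf-𝒦 i with suc i ≤? p
    ... | yes i<p = isLeaf-height≡suc (𝒦 (suc i)) (height-𝒦 i<p)
    ... | no i≮p = trans (cong isLeaf (𝒦-grown (≰⇒> i≮p))) (isLeaf-grow (iterate (grow k) (i ∸ p) T))

    𝒦-prune : ∀ i → 𝒦 i ≡ prune (𝒦 (suc i))
    𝒦-prune i with <-cmp i p
    ... | tri< i<p _ _ = begin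
      𝒦 i                                    ≡⟨ 𝒦-pruned (<⇒≤ i<p) ⟩
      iterate prune (suc p ∸ suc i) T        ≡⟨ cong (λ m → iterate prune m T) (+-∸-assoc 1 i<p) ⟩
      prune (iterate prune (p ∸ suc i) T)    ≡⟨ cong prune (sym (𝒦-pruned i<p)) ⟩
      prune (𝒦 (suc i))                      ∎
    ... | tri≈ _ refl _ = begin
      𝒦 p                                    ≡⟨ 𝒦-pruned ≤-refl ⟩
      iterate prune (p ∸ p) T                ≡⟨ cong (λ m → iterate prune m T) (n∸n≡0 p) ⟩
      T                                      ≡⟨ sym (prune-grow T) ⟩
      prune (grow k T)                       ≡⟨ cong (λ m → prune (grow k (iterate (grow k) m T))) (sym (n∸n≡0 p)) ⟩
      prune (grow k (iterate (grow k) (p ∸ p) T)) ≡⟨ cong prune (sym (𝒦-grown ≤-refl)) ⟩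
      prune (𝒦 (suc p))                      ∎
    ... | tri> _ _ p<i = begin
      𝒦 i                                    ≡⟨ 𝒦-grown p<i ⟩
      grow k t                               ≡⟨ sym (prune-grow (grow k t)) ⟩
      prune (grow k (grow k t))              ≡⟨ cong (λ m → prune (grow k (iterate (grow k) m T))) (sym (+-∸-assoc 1 p<i)) ⟩
      prune (grow k (iterate (grow k) (suc i ∸ suc p) T)) ≡⟨ cong prune (sym (𝒦-grown (m<n⇒m<1+n p<i))) ⟩
      prune (𝒦 (suc i))                      ∎
      where t = iterate (grow k) (i ∸ suc p) T

    children₁ : List Tree
    children₁ = children (𝒦 1)

    allLeaves-children₁ : allLeaves children₁ ≡ true
    allLeaves-children₁ = allLeaves-height≡1 children₁ (trans (cong height (node-children (𝒦 1))) (height-𝒦 (s≤s z≤n)))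

    pruneList-children₁ : pruneList children₁ ≡ []
    pruneList-children₁ = null⇒≡[] (trans (sym (allLeaves≡null-pruneList children₁)) allLeaves-children₁)
      where
      null⇒≡[] : ∀ {ts : List Tree} → null ts ≡ true → ts ≡ []
      null⇒≡[] {[]} _ = refl

    superPen-false : ∀ i → superPen T p k (suc (suc i)) ≡ false
    superPen-false zero = ∧-zeroʳ (allLeaves (children (𝒦 2)))
    superPen-false (suc i) = ∧-zeroʳ (allLeaves (children (𝒦 (suc (suc (suc i))))))

    innerPenFlags-block₁ : innerPenFlags (blockLabels 1) ≡ replicate s true
    innerPenFlags-block₁ = begin
      innerPenFlags (replicate j leafLabel ++ replicate s (false , allLeaves children₁) ++ preorderList j children₁)
        ≡⟨ innerPenFlags-++ (replicate j leafLabel) _ ⟩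
      innerPenFlags (replicate j leafLabel) ++ innerPenFlags (replicate s (false , allLeaves children₁) ++ preorderList j children₁)
        ≡⟨ cong₂ _++_ (innerPenFlags-replicate-leaf j false) (innerPenFlags-++ (replicate s (false , allLeaves children₁)) _) ⟩
      innerPenFlags (replicate s (false , allLeaves children₁)) ++ innerPenFlags (preorderList j children₁)
        ≡⟨ cong₂ _++_ (trans (innerPenFlags-replicate-inner s (allLeaves children₁)) (cong (replicate s) allLeaves-children₁))
                      (trans (innerPenFlags-preorderList j children₁) (cong (λ ts → leafFlags (preorderList j ts)) pruneList-children₁)) ⟩
      replicate s true ++ []
        ≡⟨ ++-identityʳ _ ⟩
      replicate s true
        ∎

    innerPenFlags-block : ∀ i → innerPenFlags (blockLabels (suc (suc i))) ≡ replicate s false ++ leafFlags (preorderList j (children (𝒦 (suc i))))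
    innerPenFlags-block i = begin
      innerPenFlags (replicate s (superInfo T p k (suc (suc i))) ++ preorderList j (children (𝒦 (suc (suc i)))))
        ≡⟨ innerPenFlags-++ (replicate s (superInfo T p k (suc (suc i)))) _ ⟩
      innerPenFlags (replicate s (superInfo T p k (suc (suc i)))) ++ innerPenFlags (preorderList j (children (𝒦 (suc (suc i)))))
        ≡⟨ cong₂ _++_ (trans (innerPenFlags-replicate-inner s _) (cong (replicate s) (superPen-false i)))
                      (innerPenFlags-preorderList j (children (𝒦 (suc (suc i))))) ⟩
      replicate s false ++ leafFlags (preorderList j (pruneList (children (𝒦 (suc (suc i))))))
        ≡⟨ cong (λ ts → replicate s false ++ leafFlags (preorderList j ts)) (sym (children-prune (𝒦 (suc (suc i))))) ⟩
      replicate s false ++ leafFlags (preorderList j (children (prune (𝒦 (suc (suc i))))))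
        ≡⟨ cong (λ t → replicate s false ++ leafFlags (preorderList j (children t))) (sym (𝒦-prune (suc i))) ⟩
      replicate s false ++ leafFlags (preorderList j (children (𝒦 (suc i))))
        ∎

    leafFlags-block : ∀ i → leafFlags (blockLabels (suc (suc i))) ≡ replicate s false ++ leafFlags (preorderList j (children (𝒦 (suc (suc i)))))
    leafFlags-block i = trans (map-++ proj₁ (replicate s (superInfo T p k (suc (suc i)))) _)
                              (cong (_++ leafFlags (preorderList j (children (𝒦 (suc (suc i)))))) (map-replicate proj₁ s _))

    leafFlags-block₁ : leafFlags (blockLabels 1) ≡ replicate j true ++ innerPenFlags (blockLabels 2)
    leafFlags-block₁ = begin
      leafFlags (replicate j leafLabel ++ replicate s (false , allLeaves children₁) ++ preorderList j children₁)
        ≡⟨ map-++ proj₁ (replicate j leafLabel) _ ⟩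
      leafFlags (replicate j leafLabel) ++ leafFlags (replicate s (false , allLeaves children₁) ++ preorderList j children₁)
        ≡⟨ cong₂ _++_ (map-replicate proj₁ j leafLabel) (map-++ proj₁ (replicate s (false , allLeaves children₁)) _) ⟩
      replicate j true ++ leafFlags (replicate s (false , allLeaves children₁)) ++ leafFlags (preorderList j children₁)
        ≡⟨ cong (λ bs → replicate j true ++ bs ++ leafFlags (preorderList j children₁)) (map-replicate proj₁ s _) ⟩
      replicate j true ++ replicate s false ++ leafFlags (preorderList j children₁)
        ≡⟨ cong (replicate j true ++_) (sym (innerPenFlags-block 0)) ⟩
      replicate j true ++ innerPenFlags (blockLabels 2)
        ∎

    innerPenFlags-shift : ∀ m → Σ[ Z ∈ List Bool ]
      innerPenFlags (labels (suc (suc m))) ≡ replicate s true ++ Z × leafFlags (labels (suc m)) ≡ replicate j true ++ Z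
    innerPenFlags-shift zero =
      innerPenFlags (blockLabels 2) ,
      trans (innerPenFlags-++ (blockLabels 1) (blockLabels 2)) (cong (_++ innerPenFlags (blockLabels 2)) innerPenFlags-block₁) ,
      leafFlags-block₁
    innerPenFlags-shift (suc m) with innerPenFlags-shift m
    ... | Z , innerPenFlags-labels , leafFlags-labels =
      Z ++ leafFlags (blockLabels (suc (suc m))) ,
      (begin
        innerPenFlags (labels (suc (suc m)) ++ blockLabels (suc (suc (suc m))))
          ≡⟨ innerPenFlags-++ (labels (suc (suc m))) _ ⟩
        innerPenFlags (labels (suc (suc m))) ++ innerPenFlags (blockLabels (suc (suc (suc m))))
          ≡⟨ cong₂ _++_ innerPenFlags-labels (trans (innerPenFlags-block (suc m)) (sym (leafFlags-block m))) ⟩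
        (replicate s true ++ Z) ++ leafFlags (blockLabels (suc (suc m)))
          ≡⟨ ++-assoc (replicate s true) Z _ ⟩
        replicate s true ++ Z ++ leafFlags (blockLabels (suc (suc m)))
          ∎) ,
      (begin
        leafFlags (labels (suc m) ++ blockLabels (suc (suc m)))
          ≡⟨ map-++ proj₁ (labels (suc m)) _ ⟩
        leafFlags (labels (suc m)) ++ leafFlags (blockLabels (suc (suc m)))
          ≡⟨ cong (_++ leafFlags (blockLabels (suc (suc m)))) leafFlags-labels ⟩
        (replicate j true ++ Z) ++ leafFlags (blockLabels (suc (suc m)))
          ≡⟨ ++-assoc (replicate j true) Z _ ⟩
        replicate j true ++ Z ++ leafFlags (blockLabels (suc (suc m)))
          ∎)

    Exclusive-block : ∀ i → All Exclusive (blockLabels i)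
    Exclusive-block zero = []
    Exclusive-block (suc zero) =
      ++⁺ (replicate⁺ j (Exclusive-regInfo leaf)) (++⁺ (replicate⁺ s λ ()) (Exclusive-preorderList j children₁))
    Exclusive-block (suc (suc i)) = ++⁺ (replicate⁺ s λ ()) (Exclusive-preorderList j (children (𝒦 (suc (suc i)))))

    Exclusive-labels : ∀ m → All Exclusive (labels m)
    Exclusive-labels zero = []
    Exclusive-labels (suc m) = ++⁺ (Exclusive-labels m) (Exclusive-block (suc m))

    Balanced-block : ∀ i → p < i → Balanced k j (blockLabels i)
    Balanced-block (suc zero) (s≤s ())
    Balanced-block (suc (suc i)) p<i =
      subst (Balanced k j) (sym grownBlock)
            (Balanced-++ (Balanced-plain s) (Balanced-preorderList-grow (children t)))
      where
      t : Tree
      t = iterate (grow k) (suc (suc i) ∸ suc p) T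
      grownBlock : blockLabels (suc (suc i)) ≡ replicate s plainLabel ++ preorderList j (growList k (children t))
      grownBlock = cong₂ (λ b ts → replicate s (false , b) ++ preorderList j ts)
                         (superPen-false i)
                         (trans (cong children (𝒦-grown p<i)) (children-grow t (isLeaf-iterate-grow (suc (suc i) ∸ suc p))))

    length-block : ∀ i → j ≤ length (blockLabels (suc i))
    length-block zero = ≤-trans (≤-reflexive (sym (length-replicate j))) (length-++-≤ˡ (replicate j leafLabel))
    length-block (suc i) =
      ≤-trans (length-preorderList-children j (𝒦 (suc (suc i))) (isLeaf-𝒦 (suc i)))
              (length-++-≤ʳ (preorderList j (children (𝒦 (suc (suc i))))) {replicate s (superInfo T p k (suc (suc i)))})

    length-labels : ∀ m → m ≤ length (labels m)
    length-labels zero = z≤n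
    length-labels (suc m) =
      ≤-trans (≤-reflexive (+-comm 1 m))
              (≤-trans (+-mono-≤ (length-labels m) (≤-trans (s≤s z≤n) (length-block m)))
                       (≤-reflexive (sym (length-++ (labels m)))))

    labels-prefix : ∀ m d → Σ[ V ∈ List Info ] labels (d + m) ≡ labels m ++ V
    labels-prefix m zero = [] , sym (++-identityʳ (labels m))
    labels-prefix m (suc d) with labels-prefix m d
    ... | V , split = V ++ blockLabels (suc (d + m)) , trans (cong (_++ blockLabels (suc (d + m))) split) (++-assoc (labels m) V _)

    labels-extend : ∀ {m m′} → m ≤ m′ → Σ[ V ∈ List Info ] labels m′ ≡ labels m ++ V
    labels-extend {m} {m′} m≤m′ with labels-prefix m (m′ ∸ m)
    ... | V , split = V , trans (cong labels (sym (m∸n+n≡m m≤m′))) split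

    Balanced-suffix : ∀ d → Σ[ U ∈ List Info ] labels (d + p) ≡ labels p ++ U × Balanced k j U
    Balanced-suffix zero = [] , sym (++-identityʳ (labels p)) , Balanced-plain 0
    Balanced-suffix (suc d) with Balanced-suffix d
    ... | U , split , bal =
      U ++ blockLabels (suc (d + p)) ,
      trans (cong (_++ blockLabels (suc (d + p))) split) (++-assoc (labels p) U _) ,
      Balanced-++ bal (Balanced-block (suc (d + p)) (s≤s (m≤n+m p d)))

    countUpTo-labels : ∀ (f : Info → Bool) {x m} → x ≤ m → countUpTo x (map f (labels x)) ≡ countUpTo x (map f (labels m))
    countUpTo-labels f {x} {m} x≤m with labels-extend x≤m
    ... | V , split = sym (begin
      countUpTo x (map f (labels m))              ≡⟨ cong (λ w → countUpTo x (map f w)) split ⟩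
      countUpTo x (map f (labels x ++ V))         ≡⟨ cong (countUpTo x) (map-++ f (labels x) V) ⟩
      countUpTo x (map f (labels x) ++ map f V)   ≡⟨ countUpTo-++-within x _ _ x≤length ⟩
      countUpTo x (map f (labels x))              ∎)
      where
      x≤length : x ≤ length (map f (labels x))
      x≤length = subst (x ≤_) (sym (length-map f (labels x))) (length-labels x)

    leafCount penCount : ℕ → ℕ
    leafCount x = countUpTo x (leafFlags (labels x))
    penCount x = countUpTo x (penFlags (labels x))

    R≡leafCount : ∀ x → R T p k j s x ≡ leafCount x
    R≡leafCount x = cong countTrue (sym (take-map x (labels x)))

    s≤penCount : ∀ x → N T p k j s 1 ≤ x → s ≤ penCount x
    s≤penCount x N₁≤x with labels-extend {1} {x} (≤-trans (length-labels 1) N₁≤x)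
    ... | V , split = subst₂ _≤_ penLabels₁ (cong (countUpTo x) (sym penFlags-split))
                             (countUpTo-≤-++ x (penFlags (labels 1)) (penFlags V))
      where
      penFlags-split : penFlags (labels x) ≡ penFlags (labels 1) ++ penFlags V
      penFlags-split = trans (cong penFlags split) (map-++ proj₂ (labels 1) V)
      penLabels₁ : countUpTo x (penFlags (labels 1)) ≡ s
      penLabels₁ = begin
        countUpTo x (penFlags (labels 1))  ≡⟨ countUpTo-complete x _ (subst (_≤ x) (sym (length-map proj₂ (labels 1))) N₁≤x) ⟩
        countTrue (penFlags (labels 1))    ≡⟨ sym (countTrue-innerPenFlags (labels 1) (Exclusive-labels 1)) ⟩
        countTrue (innerPenFlags (labels 1))    ≡⟨ cong countTrue innerPenFlags-block₁ ⟩
        countTrue (replicate s true)       ≡⟨ countTrue-replicate-true s ⟩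
        s                                  ∎

    penCount≡countUpTo-innerPenFlags : ∀ {x M} → x ≤ M → penCount x ≡ countUpTo (x ∸ leafCount x) (innerPenFlags (labels M))
    penCount≡countUpTo-innerPenFlags {x} {M} x≤M = begin
      penCount x
        ≡⟨ countUpTo-labels proj₂ x≤M ⟩
      countUpTo x (penFlags (labels M))
        ≡⟨ countUpTo-penFlags (labels M) (Exclusive-labels M) x ⟩
      countUpTo (x ∸ countUpTo x (leafFlags (labels M))) (innerPenFlags (labels M))
        ≡⟨ cong (λ c → countUpTo (x ∸ c) (innerPenFlags (labels M))) (countUpTo-labels proj₁ x≤M) ⟨
      countUpTo (x ∸ leafCount x) (innerPenFlags (labels M))
        ∎

    s≤x∸leafCount : ∀ x → N T p k j s 1 ≤ x → s ≤ x ∸ leafCount x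
    s≤x∸leafCount x N₁≤x =
      ≤-trans (s≤penCount x N₁≤x)
              (subst (_≤ x ∸ leafCount x) (sym (penCount≡countUpTo-innerPenFlags {x} ≤-refl)) (countUpTo≤ (x ∸ leafCount x) _))

    penCount-recurrence : ∀ x → N T p k j s 1 ≤ x → leafCount (x ∸ leafCount x ∸ s + j) + s ≡ penCount x + j
    penCount-recurrence x N₁≤x with innerPenFlags-shift (x + j)
    ... | Z , innerPenFlags-labels , leafFlags-labels = begin
      leafCount z + s                ≡⟨ cong (_+ s) leafCount-z ⟩
      j + countUpTo (y ∸ s) Z + s    ≡⟨ swap j (countUpTo (y ∸ s) Z) s ⟩
      s + countUpTo (y ∸ s) Z + j    ≡⟨ cong (_+ j) penCount-x ⟨
      penCount x + j                 ∎
      where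
      y z : ℕ
      y = x ∸ leafCount x
      z = y ∸ s + j
      swap : ∀ a b c → a + b + c ≡ c + b + a
      swap = solve-∀
      penCount-x : penCount x ≡ s + countUpTo (y ∸ s) Z
      penCount-x = begin
        penCount x                                         ≡⟨ penCount≡countUpTo-innerPenFlags (m≤n⇒m≤1+n (m≤n⇒m≤1+n (m≤m+n x j))) ⟩
        countUpTo y (innerPenFlags (labels (suc (suc (x + j))))) ≡⟨ cong (countUpTo y) innerPenFlags-labels ⟩
        countUpTo y (replicate s true ++ Z)                ≡⟨ countUpTo-replicate-true-++ y s Z (s≤x∸leafCount x N₁≤x) ⟩
        s + countUpTo (y ∸ s) Z                            ∎
      leafCount-z : leafCount z ≡ j + countUpTo (y ∸ s) Z
      leafCount-z = begin
        leafCount z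
          ≡⟨ countUpTo-labels proj₁ (m≤n⇒m≤1+n (+-monoˡ-≤ j (≤-trans (m∸n≤m y s) (m∸n≤m x (leafCount x))))) ⟩
        countUpTo z (leafFlags (labels (suc (x + j)))) ≡⟨ cong (countUpTo z) leafFlags-labels ⟩
        countUpTo z (replicate j true ++ Z)         ≡⟨ countUpTo-replicate-true-++ z j Z (m≤n+m j (y ∸ s)) ⟩
        j + countUpTo (z ∸ j) Z                     ≡⟨ cong (λ u → j + countUpTo u Z) (m+n∸n≡m (y ∸ s) j) ⟩
        j + countUpTo (y ∸ s) Z                     ∎

    leafCount-balance : ∀ n → N T p k j s p + k * j ≤ n →
      leafCount n + k * β T p k j s ≡ α T p k j s + ∑ k (λ i → penCount (n ∸ i * j))
    leafCount-balance n Nₚ+kj≤n with Balanced-suffix n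
    ... | U , split , bal = begin
      leafCount n + k * β′
        ≡⟨ cong (_+ k * β′) (count-beyond proj₁ n (m+n≤o⇒m≤o Nₚ Nₚ+kj≤n) ≤-refl) ⟩
      α′ + countUpTo (n ∸ Nₚ) (leafFlags U) + k * β′
        ≡⟨ cong (λ c → α′ + c + k * β′) (Balanced.count bal (n ∸ Nₚ)) ⟩
      α′ + ∑ k (λ i → countUpTo (n ∸ Nₚ ∸ i * j) (penFlags U)) + k * β′
        ≡⟨ regroup α′ _ (k * β′) ⟩
      α′ + (k * β′ + ∑ k (λ i → countUpTo (n ∸ Nₚ ∸ i * j) (penFlags U)))
        ≡⟨ cong (λ c → α′ + (c + ∑ k (λ i → countUpTo (n ∸ Nₚ ∸ i * j) (penFlags U)))) (∑-const k β′) ⟨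
      α′ + (∑ k (λ _ → β′) + ∑ k (λ i → countUpTo (n ∸ Nₚ ∸ i * j) (penFlags U)))
        ≡⟨ cong (α′ +_) (∑-distrib-+ k (λ _ → β′) _) ⟨
      α′ + ∑ k (λ i → β′ + countUpTo (n ∸ Nₚ ∸ i * j) (penFlags U))
        ≡⟨ cong (α′ +_) (∑-cong k (λ i _ i≤k → sym (penCount-term i i≤k))) ⟩
      α′ + ∑ k (λ i → penCount (n ∸ i * j))
        ∎
      where
      Nₚ α′ β′ : ℕ
      Nₚ = length (labels p)
      α′ = α T p k j s
      β′ = β T p k j s
      regroup : ∀ a b c → a + b + c ≡ a + (c + b)
      regroup = solve-∀
      count-beyond : ∀ (f : Info → Bool) x → Nₚ ≤ x → x ≤ n →
        countUpTo x (map f (labels x)) ≡ countTrue (map f (labels p)) + countUpTo (x ∸ Nₚ) (map f U)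
      count-beyond f x Nₚ≤x x≤n = begin
        countUpTo x (map f (labels x))              ≡⟨ countUpTo-labels f (≤-trans x≤n (m≤m+n n p)) ⟩
        countUpTo x (map f (labels (n + p)))        ≡⟨ cong (λ w → countUpTo x (map f w)) split ⟩
        countUpTo x (map f (labels p ++ U))         ≡⟨ cong (countUpTo x) (map-++ f (labels p) U) ⟩
        countUpTo x (map f (labels p) ++ map f U)
          ≡⟨ countUpTo-++-past x (map f (labels p)) (map f U) (subst (_≤ x) (sym (length-map f (labels p))) Nₚ≤x) ⟩
        countTrue (map f (labels p)) + countUpTo (x ∸ length (map f (labels p))) (map f U)
          ≡⟨ cong (λ l → countTrue (map f (labels p)) + countUpTo (x ∸ l) (map f U)) (length-map f (labels p)) ⟩
        countTrue (map f (labels p)) + countUpTo (x ∸ Nₚ) (map f U)   ∎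
      penCount-term : ∀ i → i ≤ k → penCount (n ∸ i * j) ≡ β′ + countUpTo (n ∸ Nₚ ∸ i * j) (penFlags U)
      penCount-term i i≤k =
        trans (count-beyond proj₂ (n ∸ i * j)
                            (m+n≤o⇒m≤o∸n Nₚ (≤-trans (+-monoʳ-≤ Nₚ (*-monoˡ-≤ j i≤k)) Nₚ+kj≤n)) (m∸n≤m n (i * j)))
              (cong (λ u → β′ + countUpTo u (penFlags U)) (∸-comm n (i * j) Nₚ))

    Nₚ+kj≤Nₚ₊₁ : N T p k j s p + k * j ≤ N T p k j s (suc p)
    Nₚ+kj≤Nₚ₊₁ = ≤-trans (+-monoʳ-≤ (length (labels p)) kj≤block) (≤-reflexive (sym (length-++ (labels p))))
      where
      t : Tree
      t = iterate (grow k) (p ∸ p) T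
      kj≤block : k * j ≤ length (blockLabels (suc p))
      kj≤block =
        ≤-trans (length-preorderList-growList k j t (isLeaf-iterate-grow (p ∸ p)))
                (≤-trans (≤-reflexive (cong (λ ts → length (preorderList j ts)) (sym children-𝒦)))
                         (length-++-≤ʳ (preorderList j (children (𝒦 (suc p)))) {replicate s (superInfo T p k (suc p))}))
        where
        children-𝒦 : children (𝒦 (suc p)) ≡ growList k (children t)
        children-𝒦 = trans (cong children (𝒦-grown ≤-refl)) (children-grow t (isLeaf-iterate-grow (p ∸ p)))

    N₁≤Nₚ : N T p k j s 1 ≤ N T p k j s p
    N₁≤Nₚ with labels-extend {1} {p} (s≤s z≤n)
    ... | V , split = subst (λ w → length (labels 1) ≤ length w) (sym split) (length-++-≤ˡ (labels 1))

    recurrence-bounds : ∀ n → N T p k j s (suc p) < n → ∀ i → i ≤ k → i * j ≤ n × N T p k j s 1 ≤ n ∸ i * j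
    recurrence-bounds n Nₚ₊₁<n i i≤k =
      ≤-trans (*-monoˡ-≤ j i≤k) (m+n≤o⇒n≤o Nₚ Nₚ+kj≤n) ,
      ≤-trans N₁≤Nₚ (m+n≤o⇒m≤o∸n Nₚ (≤-trans (+-monoʳ-≤ Nₚ (*-monoˡ-≤ j i≤k)) Nₚ+kj≤n))
      where
      Nₚ : ℕ
      Nₚ = length (labels p)
      Nₚ+kj≤n : Nₚ + k * j ≤ n
      Nₚ+kj≤n = ≤-trans Nₚ+kj≤Nₚ₊₁ (<⇒≤ Nₚ₊₁<n)

-- The recurrence over ℤ

open import Data.Integer using (ℤ; +_; -_; _+_; _-_; _*_)
open import Data.Integer.Properties using (m-n≡m⊖n; ⊖-≥; pos-+; pos-*; +-assoc; +-0-abelianGroup)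
open import Algebra.Bundles using (AbelianGroup)
open import Algebra.Properties.Group (AbelianGroup.group +-0-abelianGroup) using (x≈z//y)
open import Data.Integer.Tactic.RingSolver using (solve-∀)
import Data.Nat as ℕ
import Data.Nat.Properties as ℕ
open import Data.Product using (proj₁; proj₂)

pos-∸ : ∀ {m n} → n ≤ m → + (m ℕ.∸ n) ≡ + m - + n
pos-∸ {m} {n} n≤m = sym (trans (m-n≡m⊖n m n) (⊖-≥ n≤m))

sumFrom1-cong : ∀ k {f g : ℕ → ℤ} → (∀ i → 1 ≤ i → i ≤ k → f i ≡ g i) → sumFrom1 k f ≡ sumFrom1 k g
sumFrom1-cong zero eq = refl
sumFrom1-cong (suc k) eq =
  cong₂ _+_ (sumFrom1-cong k (λ i 1≤i i≤k → eq i 1≤i (ℕ.m≤n⇒m≤1+n i≤k))) (eq (suc k) (ℕ.s≤s ℕ.z≤n) ℕ.≤-refl)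

sumFrom1-+-const : ∀ k (f : ℕ → ℕ) c → sumFrom1 k (λ i → + f i + c) ≡ + ∑ k f + + k * c
sumFrom1-+-const zero f c = refl
sumFrom1-+-const (suc k) f c = begin
  sumFrom1 k (λ i → + f i + c) + (+ f (suc k) + c)   ≡⟨ cong (_+ (+ f (suc k) + c)) (sumFrom1-+-const k f c) ⟩
  + ∑ k f + + k * c + (+ f (suc k) + c)              ≡⟨ regroup (+ ∑ k f) (+ f (suc k)) (+ k) c ⟩
  + ∑ k f + + f (suc k) + (+ 1 + + k) * c            ≡⟨ cong₂ (λ a b → a + b * c) (sym (pos-+ (∑ k f) (f (suc k)))) (sym (pos-+ 1 k)) ⟩
  + ∑ (suc k) f + + suc k * c                        ∎
  where
  open ≡-Reasoning
  regroup : ∀ (a b k c : ℤ) → a + k * c + (b + c) ≡ a + b + (+ 1 + k) * c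
  regroup = solve-∀

module _ (k' j' s p' : ℕ) (T : Tree) (height-T : height T ≡ suc (suc p')) where
  open LabeledTree k' j' s p' T height-T
  open ≡-Reasoning

  Rℤ-recurrence-term : ∀ n → N T p k j s (suc p) < n → ∀ i → i ≤ k →
    Rℤ T p k j s (+ n - + s - (+ i - + 1) * + j - Rℤ T p k j s (+ n - + i * + j))
      ≡ + penCount (n ℕ.∸ i ℕ.* j) + (+ j - + s)
  Rℤ-recurrence-term n Nₚ₊₁<n i i≤k = begin
    Rℤ T p k j s (+ n - + s - (+ i - + 1) * + j - Rℤ T p k j s (+ n - + i * + j))
      ≡⟨ cong (λ a → Rℤ T p k j s (+ n - + s - (+ i - + 1) * + j - Rℤ T p k j s a)) n-ij≡x ⟩
    Rℤ T p k j s (+ n - + s - (+ i - + 1) * + j - + R T p k j s x)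
      ≡⟨ cong (λ l → Rℤ T p k j s (+ n - + s - (+ i - + 1) * + j - + l)) (R≡leafCount x) ⟩
    Rℤ T p k j s (+ n - + s - (+ i - + 1) * + j - + leafCount x)
      ≡⟨ cong (Rℤ T p k j s) (sym z≡argument) ⟩
    + R T p k j s z
      ≡⟨ cong +_ (R≡leafCount z) ⟩
    + leafCount z
      ≡⟨ x≈z//y (+ leafCount z) (+ s) (+ (penCount x ℕ.+ j)) pos-recurrence ⟩
    + (penCount x ℕ.+ j) - + s
      ≡⟨ cong (_- + s) (pos-+ (penCount x) j) ⟩
    + penCount x + + j - + s
      ≡⟨ +-assoc (+ penCount x) (+ j) (- + s) ⟩
    + penCount x + (+ j - + s)
      ∎
    where
    x : ℕ
    x = n ℕ.∸ i ℕ.* j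
    ij≤n : i ℕ.* j ≤ n
    ij≤n = proj₁ (recurrence-bounds n Nₚ₊₁<n i i≤k)
    N₁≤x : N T p k j s 1 ≤ x
    N₁≤x = proj₂ (recurrence-bounds n Nₚ₊₁<n i i≤k)
    n-ij≡x : + n - + i * + j ≡ + x
    n-ij≡x = trans (cong (λ a → + n - a) (sym (pos-* i j))) (sym (pos-∸ ij≤n))
    s≤y : s ≤ x ℕ.∸ leafCount x
    s≤y = s≤x∸leafCount x N₁≤x
    z : ℕ
    z = x ℕ.∸ leafCount x ℕ.∸ s ℕ.+ j
    z≡argument : + z ≡ + n - + s - (+ i - + 1) * + j - + leafCount x
    z≡argument = begin
      + (x ℕ.∸ leafCount x ℕ.∸ s ℕ.+ j)            ≡⟨ pos-+ (x ℕ.∸ leafCount x ℕ.∸ s) j ⟩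
      + (x ℕ.∸ leafCount x ℕ.∸ s) + + j            ≡⟨ cong (_+ + j) (pos-∸ s≤y) ⟩
      + (x ℕ.∸ leafCount x) - + s + + j            ≡⟨ cong (λ a → a - + s + + j) (pos-∸ (countUpTo≤ x (leafFlags (labels x)))) ⟩
      + x - + leafCount x - + s + + j              ≡⟨ cong (λ a → a - + leafCount x - + s + + j) (sym n-ij≡x) ⟩
      + n - + i * + j - + leafCount x - + s + + j  ≡⟨ reassociate (+ n) (+ i) (+ j) (+ s) (+ leafCount x) ⟩
      + n - + s - (+ i - + 1) * + j - + leafCount x ∎
      where
      reassociate : ∀ (n i j s l : ℤ) → n - i * j - l - s + j ≡ n - s - (i - + 1) * j - l
      reassociate = solve-∀
    pos-recurrence : + leafCount z + + s ≡ + (penCount x ℕ.+ j)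
    pos-recurrence = trans (sym (pos-+ (leafCount z) s)) (cong +_ (penCount-recurrence x N₁≤x))

  leafCount-recurrence : ∀ n → N T p k j s (suc p) < n →
    + leafCount n
      ≡ sumFrom1 k (λ i → + penCount (n ℕ.∸ i ℕ.* j) + (+ j - + s)) + (+ α T p k j s - + k * (+ β T p k j s - + s + + j))
  leafCount-recurrence n Nₚ₊₁<n = begin
    + leafCount n
      ≡⟨ x≈z//y (+ leafCount n) (+ k * + β′) (+ α′ + + σ) pos-balance ⟩
    + α′ + + σ - + k * + β′
      ≡⟨ rearrange (+ α′) (+ σ) (+ k) (+ β′) (+ j) (+ s) ⟩
    + σ + + k * (+ j - + s) + (+ α′ - + k * (+ β′ - + s + + j))
      ≡⟨ cong (_+ (+ α′ - + k * (+ β′ - + s + + j))) (sym (sumFrom1-+-const k (λ i → penCount (n ℕ.∸ i ℕ.* j)) (+ j - + s))) ⟩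
    sumFrom1 k (λ i → + penCount (n ℕ.∸ i ℕ.* j) + (+ j - + s)) + (+ α′ - + k * (+ β′ - + s + + j))
      ∎
    where
    α′ β′ σ : ℕ
    α′ = α T p k j s
    β′ = β T p k j s
    σ = ∑ k (λ i → penCount (n ℕ.∸ i ℕ.* j))
    pos-balance : + leafCount n + + k * + β′ ≡ + α′ + + σ
    pos-balance = begin
      + leafCount n + + k * + β′        ≡⟨ cong (λ b → + leafCount n + b) (pos-* k β′) ⟨
      + leafCount n + + (k ℕ.* β′)      ≡⟨ pos-+ (leafCount n) (k ℕ.* β′) ⟨
      + (leafCount n ℕ.+ k ℕ.* β′)      ≡⟨ cong +_ (leafCount-balance n (ℕ.≤-trans Nₚ+kj≤Nₚ₊₁ (ℕ.<⇒≤ Nₚ₊₁<n))) ⟩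
      + (α′ ℕ.+ σ)                      ≡⟨ pos-+ α′ σ ⟩
      + α′ + + σ                        ∎
    rearrange : ∀ (a σ k b j s : ℤ) → a + σ - k * b ≡ σ + k * (j - s) + (a - k * (b - s + j))
    rearrange = solve-∀

theorem1 : (k j s p : ℕ) (T : Tree) → 1 ≤ k → 1 ≤ j → 2 ≤ p → height T ≡ p →
    let ν = + α T p k j s - + k * (+ β T p k j s - + s + + j) in
    (n : ℕ) → N T p k j s (suc p) < n →
    Rℤ T p k j s (+ n)
      ≡ sumFrom1 k (λ i → Rℤ T p k j s
            (+ n - + s - (+ i - + 1) * + j - Rℤ T p k j s (+ n - + i * + j)))
        + ν
theorem1 _ _ _ (suc zero) _ _ _ (ℕ.s≤s ()) _ _ _
theorem1 (suc k') (suc j') s (suc (suc p')) T _ _ _ height-T n Nₚ₊₁<n = begin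
  + R T p k j s n
    ≡⟨ cong +_ (R≡leafCount n) ⟩
  + leafCount n
    ≡⟨ leafCount-recurrence k' j' s p' T height-T n Nₚ₊₁<n ⟩
  sumFrom1 k (λ i → + penCount (n ℕ.∸ i ℕ.* j) + (+ j - + s)) + ν
    ≡⟨ cong (_+ ν) (sumFrom1-cong k (λ i _ i≤k → sym (Rℤ-recurrence-term k' j' s p' T height-T n Nₚ₊₁<n i i≤k))) ⟩
  sumFrom1 k (λ i → Rℤ T p k j s (+ n - + s - (+ i - + 1) * + j - Rℤ T p k j s (+ n - + i * + j))) + ν
    ∎
  where
  open LabeledTree k' j' s p' T height-T
  open ≡-Reasoning
  ν : ℤ
  ν = + α T p k j s - + k * (+ β T p k j s - + s + + j)
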